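{- Let $M$ be a matroid on a finite ground set $E$ with circuit set $\mathcal{C}$, and let $\mathcal{A}_0=\{A\subseteq\mathcal{C}: |A|>\eta(\bigcup_{C\in A}C)\}$. Then every $A\in\mathcal{A}_0$ contains a matroidal cycle of the hypergraph $(E,\mathcal{C})$, i.e. there is a subset of $A$ that is a matroidal cycle.
   Context: For $S\subseteq E$, $r(S)$ is the maximum size of a subset of $S$ containing no circuit of $M$, and $\eta(S)=|S|-r(S)$ is the nullity. In a hypergraph, a collection of edges $\{e_1,\dots,e_k\}$ is doubly covering if $e_i\subseteq\bigcup_{j\neq i}e_j$ for all $i$; it is a matroidal cycle if it is doubly covering and no proper subcollection is doubly covering. -}

module Defs where

open import Data.Nat using (ℕ; _<_; _∸_; _≤_; _+_)
open import Data.Fin using (Fin)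
open import Data.Fin.Subset using (Subset; _∈_; _⊆_; _⊂_; _∪_; _-_; ⋃; ∣_∣; Nonempty)
open import Data.Fin.Subset.Properties using (_∈?_)
open import Data.List using (List; map; filter; allFin)
open import Data.Product using (Σ; ∃; _×_)
open import Relation.Binary.PropositionalEquality using (_≡_; _≢_)
open import Relation.Nullary using (¬_)
open import Function.Definitions using (Injective)

-- The circuit set 𝒞 is enumerated injectively as circuit : Fin m → Subset n
-- (so 𝒞 = { circuit i | i : Fin m }), subject to the circuit axioms.
record Matroid (n : ℕ) : Set where
  field
    m        : ℕ
    circuit  : Fin m → Subset n
    injective : Injective _≡_ _≡_ circuit
    C1 : ∀ i → Nonempty (circuit i)
    C2 : ∀ i j → circuit i ⊆ circuit j → circuit i ≡ circuit j
    C3 : ∀ i j e → i ≢ j → e ∈ circuit i → e ∈ circuit j →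
         ∃ λ k → circuit k ⊆ ((circuit i ∪ circuit j) - e)

module _ {n : ℕ} (M : Matroid n) where
  open Matroid M

  Independent : Subset n → Set
  Independent I = ∀ k → ¬ (circuit k ⊆ I)

  HasRank : Subset n → ℕ → Set
  HasRank S k =
    (Σ (Subset n) λ I → I ⊆ S × Independent I × ∣ I ∣ ≡ k) ×
    (∀ I → I ⊆ S → Independent I → ∣ I ∣ ≤ k)

  UnionOf : Subset m → Subset n
  UnionOf A = ⋃ (map circuit (filter (λ i → i ∈? A) (allFin m)))

  -- A ∈ 𝒜₀ : |A| > η(⋃A) = |⋃A| - r(⋃A)
  InA₀ : Subset m → Set
  InA₀ A = ∀ k → HasRank (UnionOf A) k → ∣ UnionOf A ∣ ∸ k < ∣ A ∣

  DoublyCovering : Subset m → Set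
  DoublyCovering B =
    Nonempty B ×
    (∀ i → i ∈ B → circuit i ⊆ ⋃ (map circuit (filter (λ j → j ∈? (B - i)) (allFin m))))

  MatroidalCycle : Subset m → Set
  MatroidalCycle B = DoublyCovering B × (∀ B′ → B′ ⊂ B → ¬ DoublyCovering B′)

-- A collection A of circuits with no doubly covering subcollection has a circuit C ∈ A with a
-- private element e, i.e. one lying in no other circuit of A. Removing C and inducting shows
-- |A| ≤ |⋃A ─ I| for every independent I ⊆ ⋃A: if e ∉ I, the element e is a new element of
-- ⋃A outside I; if e ∈ I, the basis exchange property lets us swap e for some f ∈ C ─ I first.
-- Taking I of maximum size gives |A| ≤ η(⋃A), so every A ∈ 𝒜₀ contains a doubly covering
-- subcollection, and a minimal one is a matroidal cycle.
module Submission where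

open import Defs
open import Data.Nat using (ℕ; zero; suc; _+_; _∸_; _≤_; _<_; z≤n; s≤s)
open import Data.Nat.Properties using (+-comm; ≤-trans; ≤-refl; ≤-reflexive; +-suc; +-monoʳ-≤; n≤1+n; m≤n⇒m<n∨m≡n; ≤-pred; m+n≤o⇒m≤o∸n; ≤⇒≯; module ≤-Reasoning)
import Data.Nat as ℕ
open import Data.Nat.Induction using (<-wellFounded)
open import Data.Fin using (Fin; zero; _≟_)
open import Data.Fin.Subset using (Subset; ⋃; _⊆_; _⊂_; _∈_; _∉_; _∪_; _∩_; _─_; _-_; ⁅_⁆; ∣_∣; Nonempty; inside; outside) renaming (⊥ to ∅)
open import Data.Fin.Subset.Properties
open import Data.Fin.Properties using (any?; all?)
open import Data.Vec using (_∷_; []; here; there)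
open import Data.List using ([]; _∷_; map; filter; allFin)
open import Data.List.Membership.Propositional using () renaming (_∈_ to _∈ₗ_)
import Data.List.Relation.Unary.Any as Any
open import Data.List.Membership.Propositional.Properties using (∈-allFin)
open import Data.Product using (Σ; ∃; ∃₂; _×_; _,_)
open import Data.Sum using (inj₁; inj₂)
open import Data.Empty using (⊥-elim) renaming (⊥ to Empty)
open import Function using (_∘_)
open import Induction.WellFounded using (Acc; acc)
open import Level using (Level; 0ℓ)
open import Relation.Binary.PropositionalEquality using (_≢_; refl; sym; trans; subst; cong)
open import Relation.Nullary using (¬_; yes; no; contradiction)
open import Relation.Nullary.Decidable using (_×-dec_; _→-dec_; ¬?; decidable-stable)
open import Relation.Unary using (Pred; Decidable)

private
  variable
    n : ℕ

x∈p─q⇒x∉q : ∀ {p q : Subset n} {x} → x ∈ p ─ q → x ∉ q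
x∈p─q⇒x∉q {p = inside ∷ _}  {outside ∷ _} here       ()
x∈p─q⇒x∉q {p = _ ∷ _}       {inside ∷ _}  {zero} ()
x∈p─q⇒x∉q {p = outside ∷ _} {outside ∷ _} {zero} ()
x∈p─q⇒x∉q {p = _ ∷ _}      {_ ∷ _}       (there x∈) = x∈p─q⇒x∉q x∈ ∘ drop-there

x∈p-y⇒x≢y : ∀ {p : Subset n} {x y} → x ∈ p - y → x ≢ y
x∈p-y⇒x≢y x∈ refl = x∈p─q⇒x∉q x∈ (x∈⁅x⁆ _)

x∉p-x : ∀ (p : Subset n) {x} → x ∉ p - x
x∉p-x _ x∈ = x∈p-y⇒x≢y x∈ refl

x∈p-y⇒x∈p : ∀ {p : Subset n} {x y} → x ∈ p - y → x ∈ p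
x∈p-y⇒x∈p = p─q⊆p _ _

∪-⊆ : ∀ {p q r : Subset n} → p ⊆ r → q ⊆ r → p ∪ q ⊆ r
∪-⊆ {p = p} {q} p⊆r q⊆r x∈ with x∈p∪q⁻ p q x∈
... | inj₁ x∈p = p⊆r x∈p
... | inj₂ x∈q = q⊆r x∈q

x∉p∪q : ∀ {p q : Subset n} {x} → x ∉ p → x ∉ q → x ∉ p ∪ q
x∉p∪q {p = p} {q} x∉p x∉q x∈ with x∈p∪q⁻ p q x∈
... | inj₁ x∈p = x∉p x∈p
... | inj₂ x∈q = x∉q x∈q

x∈p∪q∧x∉p⇒x∈q : ∀ {p q : Subset n} {x} → x ∈ p ∪ q → x ∉ p → x ∈ q
x∈p∪q∧x∉p⇒x∈q {p = p} {q} x∈ x∉p with x∈p∪q⁻ p q x∈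
... | inj₁ x∈p = contradiction x∈p x∉p
... | inj₂ x∈q = x∈q

x∈p∪⁅y⁆∧x≢y⇒x∈p : ∀ {p : Subset n} {x y} → x ∈ p ∪ ⁅ y ⁆ → x ≢ y → x ∈ p
x∈p∪⁅y⁆∧x≢y⇒x∈p x∈ x≢y = x∈p∪q∧x∉p⇒x∈q (subst (_ ∈_) (∪-comm _ _) x∈) (x≢y⇒x∉⁅y⁆ x≢y)

⊈⇒∃∉ : ∀ {p q : Subset n} → ¬ p ⊆ q → ∃ λ x → x ∈ p × x ∉ q
⊈⇒∃∉ {p = p} {q} p⊈q with any? (λ x → x ∈? p ×-dec ¬? (x ∈? q))
... | yes witness = witness
... | no none = contradiction (λ {x} → p⊆q x) p⊈q
  where
  p⊆q : ∀ x → x ∈ p → x ∈ q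
  p⊆q x x∈p = decidable-stable (x ∈? q) (λ x∉q → none (x , x∈p , x∉q))

∣p∪q∣≤∣p∣+∣q∣ : ∀ (p q : Subset n) → ∣ p ∪ q ∣ ≤ ∣ p ∣ + ∣ q ∣
∣p∪q∣≤∣p∣+∣q∣ []            []            = z≤n
∣p∪q∣≤∣p∣+∣q∣ (outside ∷ p) (outside ∷ q) = ∣p∪q∣≤∣p∣+∣q∣ p q
∣p∪q∣≤∣p∣+∣q∣ (inside ∷ p)  (outside ∷ q) = s≤s (∣p∪q∣≤∣p∣+∣q∣ p q)
∣p∪q∣≤∣p∣+∣q∣ (outside ∷ p) (inside ∷ q)  =
  subst (suc ∣ p ∪ q ∣ ≤_) (sym (+-suc ∣ p ∣ ∣ q ∣)) (s≤s (∣p∪q∣≤∣p∣+∣q∣ p q))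
∣p∪q∣≤∣p∣+∣q∣ (inside ∷ p)  (inside ∷ q)  =
  s≤s (≤-trans (∣p∪q∣≤∣p∣+∣q∣ p q) (+-monoʳ-≤ ∣ p ∣ (n≤1+n ∣ q ∣)))

∣p─q∣+∣q∣≤∣p∣ : ∀ (p q : Subset n) → q ⊆ p → ∣ p ─ q ∣ + ∣ q ∣ ≤ ∣ p ∣
∣p─q∣+∣q∣≤∣p∣ []            []            _   = z≤n
∣p─q∣+∣q∣≤∣p∣ (outside ∷ p) (outside ∷ q) q⊆p = ∣p─q∣+∣q∣≤∣p∣ p q (drop-∷-⊆ q⊆p)
∣p─q∣+∣q∣≤∣p∣ (inside ∷ p)  (outside ∷ q) q⊆p = s≤s (∣p─q∣+∣q∣≤∣p∣ p q (drop-∷-⊆ q⊆p))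
∣p─q∣+∣q∣≤∣p∣ (outside ∷ p) (inside ∷ q)  q⊆p with () ← q⊆p here
∣p─q∣+∣q∣≤∣p∣ (inside ∷ p)  (inside ∷ q)  q⊆p =
  subst (_≤ suc ∣ p ∣) (sym (+-suc ∣ p ─ q ∣ ∣ q ∣)) (s≤s (∣p─q∣+∣q∣≤∣p∣ p q (drop-∷-⊆ q⊆p)))

∣p∣≤1+∣p-x∣ : ∀ (p : Subset n) x → ∣ p ∣ ≤ suc ∣ p - x ∣
∣p∣≤1+∣p-x∣ p x = begin
  ∣ p ∣                   ≤⟨ p⊆q⇒∣p∣≤∣q∣ p⊆p-x∪⁅x⁆ ⟩
  ∣ (p - x) ∪ ⁅ x ⁆ ∣     ≤⟨ ∣p∪q∣≤∣p∣+∣q∣ (p - x) ⁅ x ⁆ ⟩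
  ∣ p - x ∣ + ∣ ⁅ x ⁆ ∣   ≡⟨ cong (∣ p - x ∣ +_) (∣⁅x⁆∣≡1 x) ⟩
  ∣ p - x ∣ + 1           ≡⟨ +-comm ∣ p - x ∣ 1 ⟩
  suc ∣ p - x ∣           ∎
  where
  open ≤-Reasoning
  p⊆p-x∪⁅x⁆ : p ⊆ (p - x) ∪ ⁅ x ⁆
  p⊆p-x∪⁅x⁆ {y} y∈p with y ≟ x
  ... | yes refl = q⊆p∪q _ _ (x∈⁅x⁆ y)
  ... | no y≢x   = p⊆p∪q _ (x∈p∧x≢y⇒x∈p-y y∈p y≢x)

p⊆q⇒p-x⊆q-x : ∀ {p q : Subset n} {x} → p ⊆ q → p - x ⊆ q - x
p⊆q⇒p-x⊆q-x p⊆q y∈ = x∈p∧x≢y⇒x∈p-y (p⊆q (x∈p-y⇒x∈p y∈)) (x∈p-y⇒x≢y y∈)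

p─q⊆r⇒p⊆q∪r : ∀ {p q r : Subset n} → p ─ q ⊆ r → p ⊆ q ∪ r
p─q⊆r⇒p⊆q∪r {q = q} p─q⊆r {x} x∈p with x ∈? q
... | yes x∈q = p⊆p∪q _ x∈q
... | no x∉q  = q⊆p∪q _ _ (p─q⊆r (x∈p∧x∉q⇒x∈p─q x∈p x∉q))

∣p∪q∣<∣r∣ : ∀ {p q r : Subset n} {x} → p ⊆ r → q ⊆ r → x ∈ r → x ∉ p → x ∉ q → ∣ p ∪ q ∣ < ∣ r ∣
∣p∪q∣<∣r∣ {x = x} p⊆r q⊆r x∈r x∉p x∉q = p⊂q⇒∣p∣<∣q∣ (∪-⊆ p⊆r q⊆r , x , x∈r , x∉p∪q x∉p x∉q)

module _ {ℓ : Level} {P : Pred (Subset n) ℓ} (P? : Decidable P) where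

  ∃-⊆-minimal : ∀ {p} → P p → ∃ λ q → q ⊆ p × P q × (∀ r → r ⊂ q → ¬ P r)
  ∃-⊆-minimal {p} Pp = go p Pp (<-wellFounded ∣ p ∣)
    where
    go : ∀ p → P p → Acc _<_ ∣ p ∣ → ∃ λ q → q ⊆ p × P q × (∀ r → r ⊂ q → ¬ P r)
    go p Pp (acc rec) with anySubset? (λ r → r ⊂? p ×-dec P? r)
    ... | no none = p , ⊆-refl , Pp , λ r r⊂p Pr → none (r , r⊂p , Pr)
    ... | yes (r , r⊂p , Pr) with go r Pr (rec (p⊂q⇒∣p∣<∣q∣ r⊂p))
    ...   | q , q⊆r , Pq , minimal = q , ⊆-trans q⊆r (p⊂q⇒p⊆q r⊂p) , Pq , minimal

  ∃-∣∣-maximum : ∀ {p} → P p → ∃ λ q → P q × (∀ r → P r → ∣ r ∣ ≤ ∣ q ∣)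
  ∃-∣∣-maximum {p} Pp =
    let q , Pq , maximal = maximumUpTo n in q , Pq , λ r Pr → maximal r Pr (∣p∣≤n r)
    where
    maximumUpTo : ∀ t → ∃ λ q → P q × (∀ r → P r → ∣ r ∣ ≤ t → ∣ r ∣ ≤ ∣ q ∣)
    maximumUpTo zero = p , Pp , λ _ _ r≤0 → ≤-trans r≤0 z≤n
    maximumUpTo (suc t) with anySubset? (λ r → P? r ×-dec (∣ r ∣ ℕ.≟ suc t))
    ... | yes (q , Pq , ∣q∣≡1+t) = q , Pq , λ _ _ r≤1+t → ≤-trans r≤1+t (≤-reflexive (sym ∣q∣≡1+t))
    ... | no none with maximumUpTo t
    ...   | q , Pq , maximal = q , Pq , λ r Pr r≤1+t → maximal r Pr (≤t r Pr r≤1+t)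
      where
      ≤t : ∀ r → P r → ∣ r ∣ ≤ suc t → ∣ r ∣ ≤ t
      ≤t r Pr r≤1+t with m≤n⇒m<n∨m≡n r≤1+t
      ... | inj₁ r<1+t = ≤-pred r<1+t
      ... | inj₂ ∣r∣≡1+t = contradiction (r , Pr , ∣r∣≡1+t) none

module _ {k : ℕ} {Q : Pred (Fin k) 0ℓ} (Q? : Decidable Q) (f : Fin k → Subset n) where

  x∈⋃-filter⁺ : ∀ xs {i x} → i ∈ₗ xs → Q i → x ∈ f i → x ∈ ⋃ (map f (filter Q? xs))
  x∈⋃-filter⁺ (j ∷ xs) (Any.here refl) Qi x∈fi with Q? j
  ... | yes _  = p⊆p∪q _ x∈fi
  ... | no ¬Qj = contradiction Qi ¬Qj
  x∈⋃-filter⁺ (j ∷ xs) (Any.there i∈xs) Qi x∈fi with Q? j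
  ... | yes _ = q⊆p∪q _ _ (x∈⋃-filter⁺ xs i∈xs Qi x∈fi)
  ... | no _  = x∈⋃-filter⁺ xs i∈xs Qi x∈fi

  x∈⋃-filter⁻ : ∀ xs {x} → x ∈ ⋃ (map f (filter Q? xs)) → ∃ λ i → Q i × x ∈ f i
  x∈⋃-filter⁻ []       x∈ = contradiction x∈ ∉⊥
  x∈⋃-filter⁻ (j ∷ xs) x∈ with Q? j
  ... | no _ = x∈⋃-filter⁻ xs x∈
  ... | yes Qj with x∈p∪q⁻ _ _ x∈
  ...   | inj₁ x∈fj = j , Qj , x∈fj
  ...   | inj₂ x∈⋃ = x∈⋃-filter⁻ xs x∈⋃

module _ (M : Matroid n) where
  open Matroid M renaming (circuit to C)

  ∈UnionOf⁺ : ∀ {A i x} → i ∈ A → x ∈ C i → x ∈ UnionOf M A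
  ∈UnionOf⁺ {A} {i} = x∈⋃-filter⁺ (_∈? A) C (allFin m) (∈-allFin i)

  ∈UnionOf⁻ : ∀ {A x} → x ∈ UnionOf M A → ∃ λ i → i ∈ A × x ∈ C i
  ∈UnionOf⁻ {A} = x∈⋃-filter⁻ (_∈? A) C (allFin m)

  UnionOf-mono : ∀ {A B} → B ⊆ A → UnionOf M B ⊆ UnionOf M A
  UnionOf-mono B⊆A x∈ with ∈UnionOf⁻ x∈
  ... | i , i∈B , x∈Ci = ∈UnionOf⁺ (B⊆A i∈B) x∈Ci

  independent? : Decidable (Independent M)
  independent? I = all? (λ k → ¬? (C k ⊆? I))

  independent-⊆ : ∀ {I J} → J ⊆ I → Independent M I → Independent M J
  independent-⊆ J⊆I indI k Ck⊆J = indI k (⊆-trans Ck⊆J J⊆I)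

  dependent⇒∃circuit : ∀ {I} → ¬ Independent M I → ∃ λ k → C k ⊆ I
  dependent⇒∃circuit {I} dep with any? (λ k → C k ⊆? I)
  ... | yes witness = witness
  ... | no none = contradiction (λ k Ck⊆I → none (k , λ {x} → Ck⊆I {x})) dep

  doublyCovering? : Decidable (DoublyCovering M)
  doublyCovering? B = nonempty? B ×-dec all? (λ i → i ∈? B →-dec C i ⊆? UnionOf M (B - i))

  circuit-⊈ : ∀ {i k b} → b ∈ C i → b ∉ C k → ¬ C k ⊆ C i
  circuit-⊈ {i} {k} b∈i b∉k Ck⊆Ci = b∉k (subst (_ ∈_) (sym (C2 k i Ck⊆Ci)) b∈i)

  -- If the circuit given by (C3) misses b, it leaves C i at some g ∈ C j; eliminating g and
  -- then a, each time inside a strictly smaller union, produces a circuit through b.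
  strong-elimination : ∀ i j {a b} → a ∈ C i → a ∈ C j → b ∈ C i → b ∉ C j →
                       ∃ λ k → C k ⊆ (C i ∪ C j) - a × b ∈ C k
  strong-elimination i j a∈i a∈j b∈i b∉j = go i j a∈i a∈j b∈i b∉j (<-wellFounded _)
    where
    go : ∀ i j {a b} → a ∈ C i → a ∈ C j → b ∈ C i → b ∉ C j → Acc _<_ ∣ C i ∪ C j ∣ →
         ∃ λ k → C k ⊆ (C i ∪ C j) - a × b ∈ C k
    go i j {a} {b} a∈i a∈j b∈i b∉j (acc rec) with C3 i j a (λ { refl → b∉j b∈i }) a∈i a∈j
    ... | k , k⊆ with b ∈? C k
    ... | yes b∈k = k , k⊆ , b∈k
    ... | no b∉k =
      let k⊆ij          = ⊆-trans k⊆ (p─q⊆p _ _)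
          g , g∈k , g∉i = ⊈⇒∃∉ (circuit-⊈ b∈i b∉k)
          g∈j           = x∈p∪q∧x∉p⇒x∈q (k⊆ij g∈k) g∉i
          l , l⊆ , a∈l  = go j k g∈j g∈k a∈j (x∉p-x _ ∘ k⊆)
                            (rec (∣p∪q∣<∣r∣ (q⊆p∪q _ _) k⊆ij (p⊆p∪q _ b∈i) b∉j b∉k))
          l⊆ij          = ⊆-trans l⊆ (⊆-trans (p─q⊆p _ _) (∪-⊆ (q⊆p∪q _ _) k⊆ij))
          b∉l           = x∉p∪q b∉j b∉k ∘ x∈p-y⇒x∈p ∘ l⊆
          o , o⊆ , b∈o  = go i l a∈i a∈l b∈i b∉l
                            (rec (∣p∪q∣<∣r∣ (p⊆p∪q _) l⊆ij (q⊆p∪q _ _ g∈j) g∉i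
                                            (x∉p-x _ ∘ l⊆)))
      in o , ⊆-trans o⊆ (p⊆q⇒p-x⊆q-x (∪-⊆ (p⊆p∪q _) l⊆ij)) , b∈o

  -- Each step eliminates an element f ∈ C k ─ I against its repairing circuit while keeping e,
  -- so C k ─ I shrinks until C k ⊆ I, contradicting independence.
  ¬circuit⊆I∪S : ∀ {I S e} → Independent M I →
                 (∀ {f} → f ∈ S → f ∉ I → ∃ λ d → C d ⊆ I ∪ ⁅ f ⁆ × e ∉ C d) →
                 ∀ k → e ∈ C k → ¬ C k ⊆ I ∪ S
  ¬circuit⊆I∪S {I} {S} {e} indI repair k e∈k = go k e∈k (<-wellFounded _)
    where
    step : ∀ k → e ∈ C k → C k ⊆ I ∪ S →
           ∃ λ k′ → e ∈ C k′ × C k′ ⊆ I ∪ S × C k′ ─ I ⊂ C k ─ I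
    step k e∈k k⊆I∪S =
      let f , f∈k , f∉I  = ⊈⇒∃∉ (indI k)
          d , d⊆ , e∉d   = repair (x∈p∪q∧x∉p⇒x∈q (k⊆I∪S f∈k) f∉I) f∉I
          f∈d            = decidable-stable (f ∈? C d) λ f∉d →
                             indI d (λ x∈d → x∈p∪⁅y⁆∧x≢y⇒x∈p (d⊆ x∈d) λ { refl → f∉d x∈d })
          k′ , k′⊆ , e∈k′ = strong-elimination k d f∈k f∈d e∈k e∉d
          x≢f : ∀ {x} → x ∈ C k′ → x ≢ f
          x≢f x∈k′ = x∈p-y⇒x≢y (k′⊆ x∈k′)
          k′─I⊆k─I : C k′ ─ I ⊆ C k ─ I
          k′─I⊆k─I x∈ =
            let x∈k′ = p─q⊆p _ _ x∈
                x∉I  = x∈p─q⇒x∉q x∈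
                x∉d  = λ x∈d → x∉I (x∈p∪⁅y⁆∧x≢y⇒x∈p (d⊆ x∈d) (x≢f x∈k′))
                x∈k  = x∈p∪q∧x∉p⇒x∈q (subst (_ ∈_) (∪-comm _ _) (x∈p-y⇒x∈p (k′⊆ x∈k′))) x∉d
            in x∈p∧x∉q⇒x∈p─q x∈k x∉I
          k─I⊆S : C k ─ I ⊆ S
          k─I⊆S x∈ = x∈p∪q∧x∉p⇒x∈q (k⊆I∪S (p─q⊆p _ _ x∈)) (x∈p─q⇒x∉q x∈)
      in k′ , e∈k′ , p─q⊆r⇒p⊆q∪r (⊆-trans k′─I⊆k─I k─I⊆S)
         , (k′─I⊆k─I , f , x∈p∧x∉q⇒x∈p─q f∈k f∉I , λ f∈ → x≢f (p─q⊆p _ _ f∈) refl)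

    go : ∀ k → e ∈ C k → Acc _<_ ∣ C k ─ I ∣ → ¬ C k ⊆ I ∪ S
    go k e∈k (acc rec) k⊆I∪S =
      let k′ , e∈k′ , k′⊆I∪S , shrinks = step k e∈k k⊆I∪S
      in go k′ e∈k′ (rec (p⊂q⇒∣p∣<∣q∣ shrinks)) k′⊆I∪S

  exchange : ∀ {I e k} → Independent M I → e ∈ I → e ∈ C k →
             ∃ λ f → f ∈ C k × f ∉ I × Independent M ((I - e) ∪ ⁅ f ⁆)
  exchange {I} {e} {k} indI e∈I e∈k
    with any? (λ f → f ∈? C k ×-dec ¬? (f ∈? I) ×-dec independent? ((I - e) ∪ ⁅ f ⁆))
  ... | yes witness = witness
  ... | no none = ⊥-elim (¬circuit⊆I∪S indI repair k e∈k (q⊆p∪q _ _))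
    where
    repair : ∀ {f} → f ∈ C k → f ∉ I → ∃ λ d → C d ⊆ I ∪ ⁅ f ⁆ × e ∉ C d
    repair {f} f∈k f∉I =
      let d , d⊆ = dependent⇒∃circuit (λ indJ → none (f , f∈k , f∉I , indJ))
          e∉d    = λ e∈d → f∉I (subst (_∈ I) (x∈⁅y⁆⇒x≡y f (x∈p∪q∧x∉p⇒x∈q (d⊆ e∈d) (x∉p-x _))) e∈I)
      in d , ⊆-trans d⊆ (∪-⊆ (⊆-trans (p─q⊆p _ _) (p⊆p∪q _)) (q⊆p∪q _ _)) , e∉d

  ∃-independent-avoiding : ∀ {X I i e} → Independent M I → C i ⊆ X → e ∈ C i →
                           ∃ λ J → Independent M J × e ∉ J × ∣ X ─ J ∣ ≤ ∣ X ─ I ∣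
  ∃-independent-avoiding {X} {I} {i} {e} indI i⊆X e∈i with e ∈? I
  ... | no e∉I  = I , indI , e∉I , ≤-refl
  ... | yes e∈I with exchange indI e∈I e∈i
  ...   | f , f∈i , f∉I , indJ = J , indJ , e∉J , ∣X─J∣≤∣X─I∣
    where
    J : Subset n
    J = (I - e) ∪ ⁅ f ⁆

    e∉J : e ∉ J
    e∉J = x∉p∪q (x∉p-x I)
                (λ e∈ → f∉I (subst (_∈ I) (x∈⁅y⁆⇒x≡y f e∈) e∈I))

    X─J-e⊆X─I-f : (X ─ J) - e ⊆ (X ─ I) - f
    X─J-e⊆X─I-f {x} x∈ =
      let x∈X─J = x∈p-y⇒x∈p x∈
          x∉J   = x∈p─q⇒x∉q x∈X─J
          x∉I   = λ x∈I → x∉J (p⊆p∪q _ (x∈p∧x≢y⇒x∈p-y x∈I (x∈p-y⇒x≢y x∈)))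
          x≢f   = λ { refl → x∉J (q⊆p∪q _ _ (x∈⁅x⁆ f)) }
      in x∈p∧x≢y⇒x∈p-y (x∈p∧x∉q⇒x∈p─q (p─q⊆p _ _ x∈X─J) x∉I) x≢f

    ∣X─J∣≤∣X─I∣ : ∣ X ─ J ∣ ≤ ∣ X ─ I ∣
    ∣X─J∣≤∣X─I∣ = begin
      ∣ X ─ J ∣             ≤⟨ ∣p∣≤1+∣p-x∣ (X ─ J) e ⟩
      suc ∣ (X ─ J) - e ∣   ≤⟨ s≤s (p⊆q⇒∣p∣≤∣q∣ X─J-e⊆X─I-f) ⟩
      suc ∣ (X ─ I) - f ∣   ≤⟨ x∈p⇒∣p-x∣<∣p∣ (x∈p∧x∉q⇒x∈p─q (i⊆X f∈i) f∉I) ⟩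
      ∣ X ─ I ∣             ∎
      where open ≤-Reasoning

  Acyclic : Subset m → Set
  Acyclic A = ∀ B → B ⊆ A → ¬ DoublyCovering M B

  ∃-private-element : ∀ {A} → Nonempty A → ¬ DoublyCovering M A →
                    ∃₂ λ i e → i ∈ A × e ∈ C i × e ∉ UnionOf M (A - i)
  ∃-private-element {A} neA ¬dcA with any? (λ i → i ∈? A ×-dec ¬? (C i ⊆? UnionOf M (A - i)))
  ... | yes (i , i∈A , i⊈) = let e , e∈i , e∉ = ⊈⇒∃∉ i⊈ in i , e , i∈A , e∈i , e∉
  ... | no none = contradiction (neA , covered) ¬dcA
    where
    covered : ∀ i → i ∈ A → C i ⊆ UnionOf M (A - i)
    covered i i∈A = decidable-stable (C i ⊆? UnionOf M (A - i)) (λ i⊈ → none (i , i∈A , i⊈))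

  acyclic⇒∣A∣≤∣⋃A─I∣ : ∀ {A I} → Acyclic A → Independent M I → I ⊆ UnionOf M A →
                       ∣ A ∣ ≤ ∣ UnionOf M A ─ I ∣
  acyclic⇒∣A∣≤∣⋃A─I∣ {A} = go A (<-wellFounded _)
    where
    go : ∀ A → Acc _<_ ∣ A ∣ → ∀ {I} → Acyclic A → Independent M I → I ⊆ UnionOf M A →
         ∣ A ∣ ≤ ∣ UnionOf M A ─ I ∣
    go A (acc rec) {I} acyclic indI I⊆ with nonempty? A
    ... | no ¬neA = ≤-trans (≤-reflexive (trans (cong ∣_∣ (Empty-unique ¬neA)) (∣⊥∣≡0 m))) z≤n
    ... | yes neA with ∃-private-element neA (acyclic A ⊆-refl)
    ...   | i , e , i∈A , e∈i , e∉⋃ with ∃-independent-avoiding indI (∈UnionOf⁺ i∈A) e∈i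
    ...     | J , indJ , e∉J , ∣⋃─J∣≤∣⋃─I∣ = begin
      ∣ A ∣                      ≤⟨ ∣p∣≤1+∣p-x∣ A i ⟩
      suc ∣ A - i ∣              ≤⟨ s≤s (go (A - i) (rec (x∈p⇒∣p-x∣<∣p∣ i∈A)) acyclic′
                                           (independent-⊆ (p∩q⊆p _ _) indJ) (p∩q⊆q _ _)) ⟩
      suc ∣ U′ ─ (J ∩ U′) ∣     ≤⟨ p⊂q⇒∣p∣<∣q∣ shrinks ⟩
      ∣ UnionOf M A ─ J ∣        ≤⟨ ∣⋃─J∣≤∣⋃─I∣ ⟩
      ∣ UnionOf M A ─ I ∣        ∎
      where
      open ≤-Reasoning
      U′ : Subset n
      U′ = UnionOf M (A - i)

      acyclic′ : Acyclic (A - i)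
      acyclic′ B B⊆ = acyclic B (⊆-trans B⊆ (p─q⊆p _ _))

      shrinks : U′ ─ (J ∩ U′) ⊂ UnionOf M A ─ J
      shrinks = (λ x∈ → let x∈U′ = p─q⊆p _ _ x∈ in
                  x∈p∧x∉q⇒x∈p─q (UnionOf-mono (p─q⊆p _ _) x∈U′)
                                 (λ x∈J → x∈p─q⇒x∉q x∈ (x∈p∩q⁺ (x∈J , x∈U′))))
              , e , x∈p∧x∉q⇒x∈p─q (∈UnionOf⁺ i∈A e∈i) e∉J , e∉⋃ ∘ p─q⊆p _ _

  acyclic⇒∣A∣≤η : ∀ {A k} → Acyclic A → HasRank M (UnionOf M A) k → ∣ A ∣ ≤ ∣ UnionOf M A ∣ ∸ k
  acyclic⇒∣A∣≤η acyclic ((I , I⊆ , indI , refl) , _) =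
    ≤-trans (acyclic⇒∣A∣≤∣⋃A─I∣ acyclic indI I⊆) (m+n≤o⇒m≤o∸n _ (∣p─q∣+∣q∣≤∣p∣ _ _ I⊆))

  ∃-rank : ∀ S → ∃ (HasRank M S)
  ∃-rank S =
    let I , (I⊆S , indI) , maximal = ∃-∣∣-maximum (λ I → I ⊆? S ×-dec independent? I) (⊆-min S , ∅-independent)
    in ∣ I ∣ , (I , I⊆S , indI , refl) , λ J J⊆S indJ → maximal J (J⊆S , indJ)
    where
    ∅-independent : Independent M ∅
    ∅-independent k Ck⊆∅ = let x , x∈Ck = C1 k in ∉⊥ (Ck⊆∅ x∈Ck)

mainTheorem4 : ∀ {n : ℕ} (M : Matroid n) (A : Subset (Matroid.m M)) →
    InA₀ M A → Σ (Subset (Matroid.m M)) (λ B → B ⊆ A × MatroidalCycle M B)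
mainTheorem4 M A A∈𝒜₀ with anySubset? (λ B → B ⊆? A ×-dec doublyCovering? M B)
... | yes (B , B⊆A , dcB) =
  let Z , Z⊆B , dcZ , minimal = ∃-⊆-minimal (doublyCovering? M) dcB
  in Z , ⊆-trans Z⊆B B⊆A , dcZ , minimal
... | no none =
  let k , rank = ∃-rank M (UnionOf M A)
      acyclic  = λ B B⊆A dcB → none (B , (λ {x} → B⊆A {x}) , dcB)
  in contradiction (A∈𝒜₀ k rank) (≤⇒≯ (acyclic⇒∣A∣≤η M acyclic rank))
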